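{- Let $\vec G$ be a tournament of order $n$. Then $mag(\vec G)\ge n-1$.
   Context: A tournament is an orientation of a complete graph. Two distinct vertices $x,y$ monitor an arc $a$ if $a$ lies on every shortest directed path from $x$ to $y$, or on every shortest directed path from $y$ to $x$. A monitoring arc-geodetic set (MAG-set) is a vertex set $M$ such that every arc is monitored by some pair of distinct vertices of $M$; $mag(\vec G)$ is the minimum size of an MAG-set. -}

module Defs where

open import Data.Nat using (ℕ; zero; suc; _<_)
open import Data.Fin using (Fin)
open import Data.Bool using (Bool; T)
open import Data.Sum using (_⊎_)
open import Data.Product using (_×_; ∃)
open import Data.Empty using (⊥)
open import Relation.Nullary using (¬_)
open import Relation.Binary.PropositionalEquality using (_≡_; _≢_)
open import Data.Fin.Subset using (Subset; _∈_)

Digraph : ℕ → Set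
Digraph n = Fin n → Fin n → Bool

module _ {n : ℕ} (G : Digraph n) where

  Arc : Fin n → Fin n → Set
  Arc u v = T (G u v)

  record IsTournament : Set where
    field
      irrefl   : ∀ x → ¬ Arc x x
      total    : ∀ x y → x ≢ y → Arc x y ⊎ Arc y x
      antisym  : ∀ x y → Arc x y → Arc y x → ⊥

  data Walk : Fin n → Fin n → ℕ → Set where
    [] : ∀ {x} → Walk x x zero
    _∷_ : ∀ {x z y k} → Arc x z → Walk z y k → Walk x y (suc k)

  data UsesArc (u v : Fin n) : ∀ {x y k} → Walk x y k → Set where
    here  : ∀ {y k} (a : Arc u v) (w : Walk v y k) → UsesArc u v (a ∷ w)
    there : ∀ {x z y k} (a : Arc x z) {w : Walk z y k} →
            UsesArc u v w → UsesArc u v (a ∷ w)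

  -- A shortest directed path from x to y: a walk of length k with no shorter walk.
  -- (Shortest walks are automatically paths.)
  IsShortest : ∀ {x y k} → Walk x y k → Set
  IsShortest {x} {y} {k} _ = ∀ {j} → Walk x y j → ¬ (j < k)

  -- Arc (u , v) lies on every shortest directed path from x to y,
  -- where y is required to be reachable from x (so shortest paths exist).
  OnAllShortest : Fin n → Fin n → Fin n → Fin n → Set
  OnAllShortest x y u v =
    (∃ λ k → Walk x y k) ×
    (∀ {k} (w : Walk x y k) → IsShortest w → UsesArc u v w)

  Monitors : Fin n → Fin n → Fin n → Fin n → Set
  Monitors x y u v = x ≢ y × (OnAllShortest x y u v ⊎ OnAllShortest y x u v)

  IsMAGSet : Subset n → Set
  IsMAGSet M = ∀ u v → Arc u v →
    ∃ λ x → ∃ λ y → x ∈ M × y ∈ M × Monitors x y u v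

{-# OPTIONS --safe #-}
-- Suppose a → b is an arc between two vertices outside an MAG-set M.  Call x
-- trapped if b → x and a is the only z with x → z → b.  A vertex of M from
-- which a → b is monitored is trapped.  If x is trapped, take s ∈ M
-- monitoring b → x and a shortest path s ⇝ r → b → x ⇝ t: then x → r, so
-- r = a, and the vertex p before a is again trapped with N⁺(p) ⊊ N⁺(x), since
-- p → a → b → x is a shortest path.  This infinite descent is impossible, so
-- at most one vertex lies outside M.
module Submission where

open import Defs
open import Data.Nat using (ℕ; _≤_; _∸_)
open import Data.Fin.Subset using (Subset; ∣_∣)

open import Data.Nat using (zero; suc; _+_; _<_; s≤s; z≤n)
open import Data.Nat.Properties
  using (≤-reflexive; <-≤-trans; +-suc; +-assoc; +-monoʳ-<; +-monoˡ-<; m≤n+m;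
         anyUpTo?; ∸-monoʳ-≤; m∸[m∸n]≡n; module ≤-Reasoning)
open import Data.Nat.Induction using (<-wellFounded)
open import Data.Fin using (Fin; _≟_)
open import Data.Fin.Properties using (any?)
open import Data.Fin.Subset using (_∈_; _∉_; _⊆_; _⊂_; ∁; ⁅_⁆)
open import Data.Fin.Subset.Properties
  using (nonempty?; Empty-unique; ∣⊥∣≡0; x∈⁅x⁆; ∣⁅x⁆∣≡1; p⊆q⇒∣p∣≤∣q∣; ∣p∣≤n;
         ∣∁p∣≡n∸∣p∣; x∈∁p⇒x∉p)
open import Data.Fin.Subset.Induction using (⊂-wellFounded)
open import Data.Vec using (tabulate)
open import Data.Vec.Properties using (lookup∘tabulate; []=⇒lookup; lookup⇒[]=)
open import Data.Bool using (T?)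
open import Data.Bool.Properties using (T-≡)
open import Data.Empty using (⊥-elim)
open import Data.Sum using (inj₁; inj₂)
open import Data.Product using (Σ; ∃; ∃₂; _×_; _,_)
open import Function.Bundles using (module Equivalence)
open import Induction.WellFounded using (Acc; acc)
open import Relation.Nullary using (¬_; Dec; yes; no; contradiction)
open import Relation.Nullary.Decidable using (_×-dec_)
open import Relation.Binary.PropositionalEquality
  using (_≡_; _≢_; refl; sym; trans; cong; subst)

∣∁p∣≤1 : ∀ {n} {p : Subset n} → (∀ {x y} → x ∉ p → y ∉ p → x ≡ y) → ∣ ∁ p ∣ ≤ 1
∣∁p∣≤1 {n} {p} unique with nonempty? (∁ p)
... | yes (x , x∈∁p) = subst (∣ ∁ p ∣ ≤_) (∣⁅x⁆∣≡1 x) (p⊆q⇒∣p∣≤∣q∣ ∁p⊆⁅x⁆)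
  where
  ∁p⊆⁅x⁆ : ∁ p ⊆ ⁅ x ⁆
  ∁p⊆⁅x⁆ y∈∁p with unique (x∈∁p⇒x∉p y∈∁p) (x∈∁p⇒x∉p x∈∁p)
  ... | refl = x∈⁅x⁆ x
... | no empty = subst (_≤ 1) (sym (trans (cong ∣_∣ (Empty-unique empty)) (∣⊥∣≡0 n))) z≤n

n∸1≤∣p∣ : ∀ {n} {p : Subset n} → (∀ {x y} → x ∉ p → y ∉ p → x ≡ y) → n ∸ 1 ≤ ∣ p ∣
n∸1≤∣p∣ {n} {p} unique = begin
  n ∸ 1            ≤⟨ ∸-monoʳ-≤ n (∣∁p∣≤1 unique) ⟩
  n ∸ ∣ ∁ p ∣      ≡⟨ cong (n ∸_) (∣∁p∣≡n∸∣p∣ p) ⟩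
  n ∸ (n ∸ ∣ p ∣)  ≡⟨ m∸[m∸n]≡n (∣p∣≤n p) ⟩
  ∣ p ∣            ∎
  where open ≤-Reasoning

∈∧∉⇒≢ : ∀ {n} {p : Subset n} {x y} → x ∈ p → y ∉ p → x ≢ y
∈∧∉⇒≢ x∈p y∉p refl = y∉p x∈p

module WalkProperties {n : ℕ} (G : Digraph n) where

  infixr 5 _++_
  _++_ : ∀ {x y z i j} → Walk G x y i → Walk G y z j → Walk G x z (i + j)
  []      ++ w = w
  (e ∷ v) ++ w = e ∷ (v ++ w)

  unsnoc : ∀ {x y k} → Walk G x y (suc k) → ∃ λ r → Walk G x r k × Arc G r y
  unsnoc (e ∷ []) = _ , [] , e
  unsnoc (e ∷ (f ∷ w)) with unsnoc (f ∷ w)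
  ... | r , w′ , g = r , e ∷ w′ , g

  usesArc⇒split : ∀ {x y u v k} {w : Walk G x y k} → UsesArc G u v w →
    ∃₂ λ i j → Walk G x u i × Arc G u v × Walk G v y j × i + suc j ≡ k
  usesArc⇒split (here e w) = 0 , _ , [] , e , w , refl
  usesArc⇒split (there e p) with usesArc⇒split p
  ... | i , j , P , uv , S , eq = suc i , j , e ∷ P , uv , S , cong suc eq

  usesArc-∷⁻ : ∀ {x z y u v k} {e : Arc G x z} {w : Walk G z y k} →
    x ≢ u → UsesArc G u v (e ∷ w) → UsesArc G u v w
  usesArc-∷⁻ x≢u (here _ _)  = contradiction refl x≢u
  usesArc-∷⁻ _   (there _ p) = p

  walk? : ∀ k x y → Dec (Walk G x y k)
  walk? zero x y with x ≟ y
  ... | yes refl = yes []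
  ... | no x≢y   = no λ { [] → x≢y refl }
  walk? (suc k) x y with any? (λ z → T? (G x z) ×-dec walk? k z y)
  ... | yes (z , e , w) = yes (e ∷ w)
  ... | no ∄            = no λ { (e ∷ w) → ∄ (_ , e , w) }

  shortest-walk : ∀ {x y k} → Walk G x y k → ∃₂ λ j (w : Walk G x y j) → IsShortest G w
  shortest-walk w = descend (<-wellFounded _) w
    where
    descend : ∀ {x y k} → Acc _<_ k → Walk G x y k → ∃₂ λ j (w : Walk G x y j) → IsShortest G w
    descend {x} {y} {k} (acc rs) w with anyUpTo? (λ j → walk? j x y) k
    ... | yes (j , j<k , w′) = descend (rs j<k) w′
    ... | no none            = k , w , λ w′ j<k → none (_ , j<k , w′)

  ≤-shortest : ∀ {x y j k} (w : Walk G x y k) (w′ : Walk G x y j) → j ≤ k →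
    IsShortest G w → IsShortest G w′
  ≤-shortest _ _ j≤k sh w″ lt = sh w″ (<-≤-trans lt j≤k)

  prefix-shortest : ∀ {x u v y i m j}
    (P : Walk G x u i) (W : Walk G u v m) (S : Walk G v y j) →
    IsShortest G (P ++ W ++ S) → IsShortest G (P ++ W)
  prefix-shortest {i = i} {m} {j} P W S sh w′ lt =
    sh (w′ ++ S) (<-≤-trans (+-monoˡ-< j lt) (≤-reflexive (+-assoc i m j)))

  suffix-shortest : ∀ {x u y i j} (P : Walk G x u i) (S : Walk G u y j) →
    IsShortest G (P ++ S) → IsShortest G S
  suffix-shortest {i = i} P S sh S′ lt = sh (P ++ S′) (+-monoʳ-< i lt)

  infix-shortest : ∀ {x u v y i m j}
    (P : Walk G x u i) (W : Walk G u v m) (S : Walk G v y j) →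
    IsShortest G (P ++ W ++ S) → IsShortest G W
  infix-shortest P W S sh = prefix-shortest [] W S (suffix-shortest P (W ++ S) sh)

  shortest-predecessor : ∀ {x u y i j} → x ≢ u → (P : Walk G x u i) (S : Walk G u y j) →
    IsShortest G (P ++ S) →
    ∃₂ λ r i′ → Σ (Walk G x r i′) λ P′ → Σ (Arc G r u) λ e → IsShortest G (P′ ++ e ∷ S)
  shortest-predecessor x≢u [] S sh = contradiction refl x≢u
  shortest-predecessor _ P@(_ ∷ _) S sh with unsnoc P
  ... | r , P′ , e =
    r , _ , P′ , e , ≤-shortest (P ++ S) (P′ ++ e ∷ S) (≤-reflexive (+-suc _ _)) sh

  shortest-avoids-arc-into-source : ∀ {u v y j} (w : Walk G v y j) → IsShortest G w →
    ¬ UsesArc G u v w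
  shortest-avoids-arc-into-source w sh uses with usesArc⇒split uses
  ... | i , j , _ , _ , S , eq = sh S (subst (j <_) eq (m≤n+m (suc j) i))

  record ShortestThrough (s t u v : Fin n) : Set where
    constructor through
    field
      {i j}    : ℕ
      prefix   : Walk G s u i
      arc      : Arc G u v
      suffix   : Walk G v t j
      shortest : IsShortest G (prefix ++ arc ∷ suffix)

  onAllShortest⇒through : ∀ {s t u v} → OnAllShortest G s t u v → ShortestThrough s t u v
  onAllShortest⇒through ((_ , w) , onAll) with shortest-walk w
  ... | _ , W , sh with usesArc⇒split (onAll W sh)
  ... | _ , _ , P , e , S , eq = through P e S (≤-shortest W (P ++ e ∷ S) (≤-reflexive eq) sh)

  out : Fin n → Subset n
  out x = tabulate (G x)

  arc⇒∈out : ∀ {x z} → Arc G x z → z ∈ out x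
  arc⇒∈out {x} {z} xz =
    lookup⇒[]= z (out x) (trans (lookup∘tabulate (G x) z) (Equivalence.to T-≡ xz))

  ∈out⇒arc : ∀ {x z} → z ∈ out x → Arc G x z
  ∈out⇒arc {x} {z} z∈out =
    Equivalence.from T-≡ (trans (sym (lookup∘tabulate (G x) z)) ([]=⇒lookup z∈out))

  Trapped : Fin n → Fin n → Fin n → Set
  Trapped a b x = Arc G b x × (∀ {z} → Arc G x z → Arc G z b → z ≡ a)

module TournamentProperties {n : ℕ} {G : Digraph n} (T : IsTournament G) where
  open IsTournament T
  open WalkProperties G

  shortest⇒back-arc : ∀ {x y k} (w : Walk G x y k) → 1 < k → IsShortest G w → Arc G y x
  shortest⇒back-arc {x} {y} _ 1<k@(s≤s (s≤s _)) sh with x ≟ y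
  ... | yes refl = ⊥-elim (sh [] (s≤s z≤n))
  ... | no x≢y with total x y x≢y
  ...   | inj₁ xy = ⊥-elim (sh (xy ∷ []) 1<k)
  ...   | inj₂ yx = yx

  shortest⇒out⊆ : ∀ {x y k} (w : Walk G x y k) → 2 < k → IsShortest G w →
    ∀ {z} → Arc G x z → Arc G y z
  shortest⇒out⊆ {y = y} _ 2<k@(s≤s (s≤s (s≤s _))) sh {z} xz with z ≟ y
  ... | yes refl = ⊥-elim (sh (xz ∷ []) (s≤s (s≤s z≤n)))
  ... | no z≢y with total z y z≢y
  ...   | inj₁ zy = ⊥-elim (sh (xz ∷ (zy ∷ [])) 2<k)
  ...   | inj₂ yz = yz

  out⊂out : ∀ {x y} → (∀ {z} → Arc G x z → Arc G y z) → Arc G y x → out x ⊂ out y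
  out⊂out {x} x⊆y yx =
    (λ z∈out → arc⇒∈out (x⊆y (∈out⇒arc z∈out))) ,
    x , arc⇒∈out yx , λ x∈out → irrefl x (∈out⇒arc x∈out)

  trapped-source : ∀ {a b s t} → s ≢ a → s ≢ b → OnAllShortest G s t a b → Trapped a b s
  trapped-source {a} {b} {s} {t} s≢a s≢b on@(_ , onAll) with onAllShortest⇒through on
  ... | through [] _ _ _ = contradiction refl s≢a
  ... | through {suc i} {j} pre ab post sh = b→s , only-a
    where
    b→s : Arc G b s
    b→s = shortest⇒back-arc (pre ++ ab ∷ []) (s≤s (m≤n+m 1 i))
            (prefix-shortest pre (ab ∷ []) post sh)
    only-a : ∀ {z} → Arc G s z → Arc G z b → z ≡ a
    only-a {z} sz zb with z ≟ a
    ... | yes z≡a = z≡a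
    -- The detour is shortest too, so it contains a → b; as s, z ≢ a, that arc
    -- would lead back into b inside the shortest walk post.
    ... | no z≢a = ⊥-elim (shortest-avoids-arc-into-source post post-shortest
                     (usesArc-∷⁻ z≢a (usesArc-∷⁻ s≢a (onAll detour detour-shortest))))
      where
      detour : Walk G s t (2 + j)
      detour = sz ∷ (zb ∷ post)
      detour-shortest : IsShortest G detour
      detour-shortest = ≤-shortest (pre ++ ab ∷ post) detour (s≤s (m≤n+m (suc j) i)) sh
      post-shortest : IsShortest G post
      post-shortest = suffix-shortest (sz ∷ (zb ∷ [])) post detour-shortest

  trapped-predecessor : ∀ {a b x p s t i j} → Trapped a b x →
    (P : Walk G s p i) (pa : Arc G p a) (ab : Arc G a b) (bx : Arc G b x) (S : Walk G x t j) →
    IsShortest G (P ++ pa ∷ (ab ∷ (bx ∷ S))) → Trapped a b p × out p ⊂ out x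
  trapped-predecessor {b = b} {x = x} {p = p} (_ , only-a) P pa ab bx S sh =
    (b→p , λ pz zb → only-a (p⊆x pz) zb) , out⊂out p⊆x x→p
    where
    p⇝b : IsShortest G (pa ∷ (ab ∷ []))
    p⇝b = infix-shortest P (pa ∷ (ab ∷ [])) (bx ∷ S) sh
    p⇝x : IsShortest G (pa ∷ (ab ∷ (bx ∷ [])))
    p⇝x = infix-shortest P (pa ∷ (ab ∷ (bx ∷ []))) S sh
    b→p : Arc G b p
    b→p = shortest⇒back-arc (pa ∷ (ab ∷ [])) (s≤s (s≤s z≤n)) p⇝b
    x→p : Arc G x p
    x→p = shortest⇒back-arc (pa ∷ (ab ∷ (bx ∷ []))) (s≤s (s≤s z≤n)) p⇝x
    p⊆x : ∀ {z} → Arc G p z → Arc G x z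
    p⊆x = shortest⇒out⊆ (pa ∷ (ab ∷ (bx ∷ []))) (s≤s (s≤s (s≤s z≤n))) p⇝x

  trapped-descent : ∀ {a b x s t} → s ≢ a → s ≢ b → OnAllShortest G s t b x → Trapped a b x →
    ∃ λ p → Trapped a b p × out p ⊂ out x
  trapped-descent s≢a s≢b on trapped@(_ , only-a) with onAllShortest⇒through on
  ... | through pre bx post sh with shortest-predecessor s≢b pre (bx ∷ post) sh
  ... | r , _ , pre′ , rb , sh′
    with only-a {r} (shortest⇒back-arc (rb ∷ (bx ∷ [])) (s≤s (s≤s z≤n))
                   (infix-shortest pre′ (rb ∷ (bx ∷ [])) post sh′)) rb
  ... | refl with shortest-predecessor s≢a pre′ (rb ∷ (bx ∷ post)) sh′
  ... | p , _ , pre″ , pa , sh″ = p , trapped-predecessor trapped pre″ pa rb bx post sh″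

module _ {n : ℕ} {G : Digraph n} (T : IsTournament G) {M : Subset n} (mag : IsMAGSet G M) where
  open IsTournament T
  open WalkProperties G
  open TournamentProperties T

  monitored-from : ∀ {u v} → Arc G u v → ∃₂ λ s t → s ∈ M × OnAllShortest G s t u v
  monitored-from uv with mag _ _ uv
  ... | x , y , x∈M , _ , _ , inj₁ on = x , y , x∈M , on
  ... | x , y , _ , y∈M , _ , inj₂ on = y , x , y∈M , on

  ¬trapped : ∀ {a b} → a ∉ M → b ∉ M → ∀ x → ¬ Trapped a b x
  ¬trapped {a} {b} a∉M b∉M x = descend x (⊂-wellFounded (out x))
    where
    descend : ∀ x → Acc _⊂_ (out x) → ¬ Trapped a b x
    descend x (acc rs) trapped@(bx , _) with monitored-from bx
    ... | s , _ , s∈M , on with trapped-descent (∈∧∉⇒≢ s∈M a∉M) (∈∧∉⇒≢ s∈M b∉M) on trapped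
    ... | p , trapped-p , p⊂x = descend p (rs p⊂x) trapped-p

  ¬arc-outside : ∀ {a b} → a ∉ M → b ∉ M → ¬ Arc G a b
  ¬arc-outside a∉M b∉M ab with monitored-from ab
  ... | s , _ , s∈M , on =
    ¬trapped a∉M b∉M s (trapped-source (∈∧∉⇒≢ s∈M a∉M) (∈∧∉⇒≢ s∈M b∉M) on)

  outside-unique : ∀ {a b} → a ∉ M → b ∉ M → a ≡ b
  outside-unique {a} {b} a∉M b∉M with a ≟ b
  ... | yes a≡b = a≡b
  ... | no a≢b with total a b a≢b
  ...   | inj₁ ab = contradiction ab (¬arc-outside a∉M b∉M)
  ...   | inj₂ ba = contradiction ba (¬arc-outside b∉M a∉M)

theorem5 : (n : ℕ) (G : Digraph n) → IsTournament G →
    (M : Subset n) → IsMAGSet G M → n ∸ 1 ≤ ∣ M ∣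
theorem5 n G T M mag = n∸1≤∣p∣ (outside-unique T mag)
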